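{- Let $F$ be a finite Frobenius group with abelian Frobenius complement $H$. Assume that the natural action of $F$ on the right cosets of $H$ is $2$-closed. If $|H|>2$, then the inner holomorph of $F$ (as a permutation group on $F$) is $3$-closed.
   Context: The inner holomorph of a group $F$ is the permutation group $F_L\cdot F_R\le S_F$, where $F_L$ and $F_R$ are the left and right regular representations of $F$; equivalently it is the image of $F\times F$ acting on $F$ by $x\mapsto g^{ -1}xh$. For a permutation group $G\le S_\Omega$ and $k\ge1$, the $k$-closure $G^{(k)}$ is the largest subgroup of $S_\Omega$ having the same orbits as $G$ on $\Omega^k$ (ordered $k$-tuples); $G$ is $k$-closed if $G^{(k)}=G$. -}

module Defs where

open import Data.Nat using (ℕ; _<_)
open import Data.Fin using (Fin)
open import Data.Fin.Subset using (Subset; _∈_; _∉_; ∣_∣)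
open import Data.Product using (Σ; ∃; _×_; _,_)
open import Relation.Binary.PropositionalEquality using (_≡_; _≢_)
open import Relation.Nullary using (¬_)
open import Level using (0ℓ)

-- Finite groups: a finite group of order n, with carrier Fin n and
-- propositional equality (every finite group is isomorphic to one such).

record FinGroup (n : ℕ) : Set where
  infixl 7 _·_
  field
    _·_       : Fin n → Fin n → Fin n
    e         : Fin n
    inv       : Fin n → Fin n
    assoc     : ∀ x y z → (x · y) · z ≡ x · (y · z)
    identityˡ : ∀ x → e · x ≡ x
    identityʳ : ∀ x → x · e ≡ x
    inverseˡ  : ∀ x → inv x · x ≡ e
    inverseʳ  : ∀ x → x · inv x ≡ e

module _ {n : ℕ} (G : FinGroup n) where
  open FinGroup G

  record IsSubgroup (H : Subset n) : Set where
    field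
      e∈   : e ∈ H
      ·∈   : ∀ {x y} → x ∈ H → y ∈ H → x · y ∈ H
      inv∈ : ∀ {x} → x ∈ H → inv x ∈ H

  record IsFrobeniusComplement (H : Subset n) : Set where
    field
      subgroup    : IsSubgroup H
      nontrivial  : ∃ λ h → h ∈ H × h ≢ e
      proper      : ∃ λ g → g ∉ H
      malnormal   : ∀ g → g ∉ H → ∀ x → x ∈ H → (inv g · x) · g ∈ H → x ≡ e

  IsAbelianSubset : Subset n → Set
  IsAbelianSubset H = ∀ x y → x ∈ H → y ∈ H → x · y ≡ y · x

  record IsRightAction {Ω : Set} (act : Fin n → Ω → Ω) : Set where
    field
      act-e : ∀ ω → act e ω ≡ ω
      act-· : ∀ g h ω → act (g · h) ω ≡ act h (act g ω)

  -- act is (permutation-isomorphic to) the natural action of G on the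
  -- right cosets of H: a transitive right action in which the stabiliser
  -- of the point ω₀ (playing the role of the coset H) is exactly H.
  record IsRightCosetAction (H : Subset n) {Ω : Set}
           (act : Fin n → Ω → Ω) (ω₀ : Ω) : Set where
    field
      action     : IsRightAction act
      transitive : ∀ ω ω′ → ∃ λ g → act g ω ≡ ω′
      stabiliser : ∀ g → (act g ω₀ ≡ ω₀ → g ∈ H) × (g ∈ H → act g ω₀ ≡ ω₀)

  innerHolAct : Fin n × Fin n → Fin n → Fin n
  innerHolAct (g , h) x = (inv g · x) · h

record Perm (Ω : Set) : Set where
  field
    to      : Ω → Ω
    from    : Ω → Ω
    to-from : ∀ ω → to (from ω) ≡ ω
    from-to : ∀ ω → from (to ω) ≡ ω
open Perm public

record IsPermSubgroup {Ω : Set} (K : Perm Ω → Set) : Set where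
  field
    has-id  : ∃ λ p → K p × (∀ ω → to p ω ≡ ω)
    has-∘   : ∀ p q → K p → K q → ∃ λ r → K r × (∀ ω → to r ω ≡ to q (to p ω))
    has-inv : ∀ p → K p → ∃ λ r → K r × (∀ ω → to r ω ≡ from p ω)

-- The permutation group G ≤ Sym(Ω) is the image of an action
-- act : A → Ω → Ω.  σ ∈ G:
InImage : {A Ω : Set} → (A → Ω → Ω) → Perm Ω → Set
InImage {A} act σ = ∃ λ (a : A) → ∀ ω → to σ ω ≡ act a ω

SameOrbits : {A Ω : Set} (k : ℕ) → (A → Ω → Ω) → (Perm Ω → Set) → Set
SameOrbits {A} {Ω} k act K =
  ∀ (x y : Fin k → Ω) →
    ((∃ λ σ → K σ × (∀ i → to σ (x i) ≡ y i)) → (∃ λ (a : A) → ∀ i → act a (x i) ≡ y i))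
  × ((∃ λ (a : A) → ∀ i → act a (x i) ≡ y i) → (∃ λ σ → K σ × (∀ i → to σ (x i) ≡ y i)))

-- G is k-closed, i.e. G^(k) = G: G^(k) is the largest subgroup of Sym(Ω)
-- with the same orbits as G on Ω^k, so G^(k) = G iff every subgroup of
-- Sym(Ω) with the same orbits on Ω^k as G is contained in G.
IsKClosed : {A Ω : Set} (k : ℕ) → (A → Ω → Ω) → Set₁
IsKClosed {A} {Ω} k act =
  ∀ (K : Perm Ω → Set) → IsPermSubgroup K → SameOrbits k act K →
    ∀ σ → K σ → InImage act σ

-- A permutation f preserving the orbits of the inner holomorph on triples agrees with
-- some x ↦ g⁻¹xh on every triple; after a right translation f 1 = 1, and then f agrees
-- with a conjugation on every pair.  The centraliser of 1 ≠ h₀ ∈ H is H, so the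
-- conjugates of h₀ correspond to the cosets of H and f induces a permutation of the
-- cosets preserving the 2-orbits of F.  By 2-closedness it is given by some c ∈ F, and f
-- is conjugation by c on the union U of the conjugates of H; composing with conjugation
-- by c⁻¹, f fixes U pointwise.  If f moved some z ∉ U, a counting argument (an injective
-- self-map of F) shows that every element outside U centralises z.  Running the coset
-- argument once more on x ↦ f(xa)a⁻¹ for 1 ≠ a ∈ H, with a second nontrivial element of
-- H at hand, then forces f z = z.
module Submission where

open import Defs
open import Level using (0ℓ)
open import Algebra.Bundles using (Group)
import Algebra.Properties.Group as GroupProperties
import Algebra.Solver.Monoid as MonoidSolver
open import Data.Empty using (⊥; ⊥-elim)
open import Data.Fin using (Fin; zero; suc; punchOut)
open import Data.Fin.Properties using (any?; _≟_; punchOut-injective; injective⇒≤)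
open import Data.Fin.Subset using (Subset; _∈_; _∉_; ∣_∣; _∪_; ⁅_⁆; _⊆_; inside; outside)
open import Data.Fin.Subset.Properties using (_∈?_; x∈⁅x⁆; x∈p∪q⁺; p⊆q⇒∣p∣≤∣q∣; ∣⁅x⁆∣≡1)
open import Data.Nat using (ℕ; suc; _<_; _≤_; _+_; z≤n; s≤s)
open import Data.Nat.Properties using (≤-trans; ≤-reflexive; +-suc; +-monoʳ-≤; n≤1+n; ≤⇒≯; 1+n≰n)
open import Data.Product using (∃; _×_; _,_; proj₁; proj₂)
open import Data.Sum using (inj₁; inj₂)
open import Data.Vec using (_∷_; []; lookup)
open import Function using (_∘_)
open import Function.Definitions using (Injective)
open import Relation.Binary.PropositionalEquality
open import Relation.Nullary using (¬_; Dec; yes; no; contradiction)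
open import Relation.Nullary.Decidable using (¬?; _×-dec_)

injective⇒surjective : ∀ {k} {f : Fin k → Fin k} → Injective _≡_ _≡_ f →
                       ∀ y → ∃ λ x → f x ≡ y
injective⇒surjective {suc k} {f} f-injective y with any? (λ x → f x ≟ y)
... | yes hit  = hit
... | no  miss = contradiction (injective⇒≤ {f = punched} punched-injective) 1+n≰n
  where
  avoids : ∀ x → y ≢ f x
  avoids x y≡fx = miss (x , sym y≡fx)

  punched : Fin (suc k) → Fin k
  punched x = punchOut (avoids x)

  punched-injective : Injective _≡_ _≡_ punched
  punched-injective eq = f-injective (punchOut-injective (avoids _) (avoids _) eq)

injective⇒perm : ∀ {k} (f : Fin k → Fin k) → Injective _≡_ _≡_ f → Perm (Fin k)
injective⇒perm f f-injective = record
  { to      = f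
  ; from    = λ y → proj₁ (onto y)
  ; to-from = λ y → proj₂ (onto y)
  ; from-to = λ x → f-injective (proj₂ (onto (f x)))
  }
  where onto = injective⇒surjective f-injective

∣p∪q∣≤∣p∣+∣q∣ : ∀ {n} (p q : Subset n) → ∣ p ∪ q ∣ ≤ ∣ p ∣ + ∣ q ∣
∣p∪q∣≤∣p∣+∣q∣ []            []            = z≤n
∣p∪q∣≤∣p∣+∣q∣ (outside ∷ p) (outside ∷ q) = ∣p∪q∣≤∣p∣+∣q∣ p q
∣p∪q∣≤∣p∣+∣q∣ (outside ∷ p) (inside  ∷ q) =
  ≤-trans (s≤s (∣p∪q∣≤∣p∣+∣q∣ p q)) (≤-reflexive (sym (+-suc ∣ p ∣ ∣ q ∣)))
∣p∪q∣≤∣p∣+∣q∣ (inside  ∷ p) (outside ∷ q) = s≤s (∣p∪q∣≤∣p∣+∣q∣ p q)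
∣p∪q∣≤∣p∣+∣q∣ (inside  ∷ p) (inside  ∷ q) =
  s≤s (≤-trans (∣p∪q∣≤∣p∣+∣q∣ p q) (+-monoʳ-≤ ∣ p ∣ (n≤1+n ∣ q ∣)))

2<∣p∣⇒∃∈-avoiding : ∀ {n} {p : Subset n} → 2 < ∣ p ∣ →
                    ∀ x y → ∃ λ z → z ∈ p × z ≢ x × z ≢ y
2<∣p∣⇒∃∈-avoiding {p = p} 2<∣p∣ x y
  with any? (λ z → z ∈? p ×-dec ¬? (z ≟ x) ×-dec ¬? (z ≟ y))
... | yes found = found
... | no  none  =
  contradiction 2<∣p∣ (≤⇒≯ (≤-trans (p⊆q⇒∣p∣≤∣q∣ p⊆⁅x⁆∪⁅y⁆) ∣⁅x⁆∪⁅y⁆∣≤2))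
  where
  p⊆⁅x⁆∪⁅y⁆ : p ⊆ ⁅ x ⁆ ∪ ⁅ y ⁆
  p⊆⁅x⁆∪⁅y⁆ {z} z∈p with z ≟ x | z ≟ y
  ... | yes refl | _        = x∈p∪q⁺ (inj₁ (x∈⁅x⁆ z))
  ... | no _     | yes refl = x∈p∪q⁺ (inj₂ (x∈⁅x⁆ z))
  ... | no z≢x   | no z≢y   = ⊥-elim (none (z , z∈p , z≢x , z≢y))

  ∣⁅x⁆∪⁅y⁆∣≤2 : ∣ ⁅ x ⁆ ∪ ⁅ y ⁆ ∣ ≤ 2
  ∣⁅x⁆∪⁅y⁆∣≤2 = ≤-trans (∣p∪q∣≤∣p∣+∣q∣ ⁅ x ⁆ ⁅ y ⁆)
                        (≤-reflexive (cong₂ _+_ (∣⁅x⁆∣≡1 x) (∣⁅x⁆∣≡1 y)))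

-- On each k-tuple f agrees with a single act a.  For a permutation of Ω this says that
-- it preserves every orbit on Ωᵏ, i.e. that it lies in the k-closure.
IsLocal : ∀ {A Ω : Set} (k : ℕ) → (A → Ω → Ω) → (Ω → Ω) → Set
IsLocal {A} {Ω} k act f = ∀ (xs : Fin k → Ω) → ∃ λ (a : A) → ∀ i → act a (xs i) ≡ f (xs i)

sameOrbits⇒isLocal : ∀ {A Ω k} {act : A → Ω → Ω} {K : Perm Ω → Set} →
                     SameOrbits k act K → ∀ {σ} → K σ → IsLocal k act (to σ)
sameOrbits⇒isLocal sameOrbits {σ} σ∈K xs =
  proj₁ (sameOrbits xs (to σ ∘ xs)) (σ , σ∈K , λ _ → refl)

isLocal-act : ∀ {A Ω k} (act : A → Ω → Ω) a → IsLocal k act (act a)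
isLocal-act _ a _ = a , λ _ → refl

isLocal-∘ : ∀ {A Ω k} (act : A → Ω → Ω) {_⊗_ : A → A → A} →
            (∀ a b ω → act (a ⊗ b) ω ≡ act b (act a ω)) →
            ∀ {f g} → IsLocal k act f → IsLocal k act g → IsLocal k act (g ∘ f)
isLocal-∘ act {_⊗_} act-⊗ {f} {g} f-local g-local xs
  with a , fa ← f-local xs | b , gb ← g-local (f ∘ xs)
  = a ⊗ b , λ i → trans (act-⊗ a b (xs i)) (trans (cong (act b) (fa i)) (gb i))

module RightActionProperties {n} {G : FinGroup n} {Ω : Set} {act : Fin n → Ω → Ω}
                             (isAction : IsRightAction G act) where
  open FinGroup G
  open IsRightAction isAction
  open ≡-Reasoning

  act-inv-act : ∀ g ω → act (inv g) (act g ω) ≡ ω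
  act-inv-act g ω = begin
    act (inv g) (act g ω)  ≡⟨ act-· g (inv g) ω ⟨
    act (g · inv g) ω      ≡⟨ cong (λ h → act h ω) (inverseʳ g) ⟩
    act e ω                ≡⟨ act-e ω ⟩
    ω                      ∎

  act-act-inv : ∀ g ω → act g (act (inv g) ω) ≡ ω
  act-act-inv g ω = begin
    act g (act (inv g) ω)  ≡⟨ act-· (inv g) g ω ⟨
    act (inv g · g) ω      ≡⟨ cong (λ h → act h ω) (inverseˡ g) ⟩
    act e ω                ≡⟨ act-e ω ⟩
    ω                      ∎

  act-injective : ∀ g {ω ω′} → act g ω ≡ act g ω′ → ω ≡ ω′
  act-injective g {ω} {ω′} eq = begin
    ω                       ≡⟨ act-inv-act g ω ⟨
    act (inv g) (act g ω)   ≡⟨ cong (act (inv g)) eq ⟩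
    act (inv g) (act g ω′)  ≡⟨ act-inv-act g ω′ ⟩
    ω′                      ∎

  act-≡⇒act-quotient : ∀ {g g′ ω ω′} → act g ω ≡ act g′ ω′ → act (g · inv g′) ω ≡ ω′
  act-≡⇒act-quotient {g} {g′} {ω} {ω′} eq = begin
    act (g · inv g′) ω        ≡⟨ act-· g (inv g′) ω ⟩
    act (inv g′) (act g ω)    ≡⟨ cong (act (inv g′)) eq ⟩
    act (inv g′) (act g′ ω′)  ≡⟨ act-inv-act g′ ω′ ⟩
    ω′                        ∎

  act-quotient⇒act-≡ : ∀ {g g′ ω ω′} → act (g · inv g′) ω ≡ ω′ → act g ω ≡ act g′ ω′
  act-quotient⇒act-≡ {g} {g′} {ω} {ω′} eq = begin
    act g ω                          ≡⟨ act-act-inv g′ (act g ω) ⟨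
    act g′ (act (inv g′) (act g ω))  ≡⟨ cong (act g′) (act-· g (inv g′) ω) ⟨
    act g′ (act (g · inv g′) ω)      ≡⟨ cong (act g′) eq ⟩
    act g′ ω′                        ∎

  stabiliser-· : ∀ {g h ω} → act g ω ≡ ω → act h ω ≡ ω → act (g · h) ω ≡ ω
  stabiliser-· {g} {h} {ω} gω≡ω hω≡ω =
    trans (act-· g h ω) (trans (cong (act h) gω≡ω) hω≡ω)

  stabiliser-inv : ∀ {g ω} → act g ω ≡ ω → act (inv g) ω ≡ ω
  stabiliser-inv {g} {ω} gω≡ω = trans (cong (act (inv g)) (sym gω≡ω)) (act-inv-act g ω)

  actPerm : Fin n → Perm Ω
  actPerm g = record
    { to = act g ; from = act (inv g) ; to-from = act-act-inv g ; from-to = act-inv-act g }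

  isLocal-inverse : ∀ {k f g} → IsLocal k act f → (∀ ω → f (g ω) ≡ ω) → IsLocal k act g
  isLocal-inverse {f = f} {g} f-local fg≗id xs with a , fa ← f-local (g ∘ xs) =
    inv a , λ i → begin
      act (inv a) (xs i)              ≡⟨ cong (act (inv a)) (trans (fa i) (fg≗id (xs i))) ⟨
      act (inv a) (act a (g (xs i)))  ≡⟨ act-inv-act a (g (xs i)) ⟩
      g (xs i)                        ∎

  isLocal₂⇒injective : ∀ {f} → IsLocal 2 act f → Injective _≡_ _≡_ f
  isLocal₂⇒injective {f} f-local {ω} {ω′} fω≡fω′
    with a , fa ← f-local (lookup (ω ∷ ω′ ∷ []))
    = act-injective a (trans (fa zero) (trans fω≡fω′ (sym (fa (suc zero)))))

module _ {n} {G : FinGroup n} {m} {act : Fin n → Fin m → Fin m}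
         (isAction : IsRightAction G act) where
  open FinGroup G
  open IsRightAction isAction
  open RightActionProperties isAction

  -- The k-local permutations form a group with the same orbits on k-tuples,
  -- so k-closedness puts all of them in the image.
  kClosed⇒isLocal⇒inImage : ∀ {k} → IsKClosed k act → ∀ {π} → Injective _≡_ _≡_ π →
                             IsLocal k act π → ∃ λ c → ∀ ω → π ω ≡ act c ω
  kClosed⇒isLocal⇒inImage {k} closed {π} π-injective =
    closed Local local-isPermSubgroup local-sameOrbits (injective⇒perm π π-injective)
    where
    Local : Perm (Fin m) → Set
    Local σ = IsLocal k act (to σ)

    _⨾_ : Perm (Fin m) → Perm (Fin m) → Perm (Fin m)
    σ ⨾ τ = record
      { to      = to τ ∘ to σ
      ; from    = from σ ∘ from τ
      ; to-from = λ ω → trans (cong (to τ) (to-from σ (from τ ω))) (to-from τ ω)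
      ; from-to = λ ω → trans (cong (from σ) (from-to τ (to σ ω))) (from-to σ ω)
      }

    _⁻¹ₚ : Perm (Fin m) → Perm (Fin m)
    σ ⁻¹ₚ = record { to = from σ ; from = to σ ; to-from = from-to σ ; from-to = to-from σ }

    local-isPermSubgroup : IsPermSubgroup Local
    local-isPermSubgroup = record
      { has-id  = actPerm e , isLocal-act act e , act-e
      ; has-∘   = λ σ τ σ-local τ-local →
                    σ ⨾ τ , isLocal-∘ act act-· {to σ} {to τ} σ-local τ-local , λ _ → refl
      ; has-inv = λ σ σ-local →
                    σ ⁻¹ₚ , isLocal-inverse {f = to σ} σ-local (to-from σ) , λ _ → refl
      }

    local-sameOrbits : SameOrbits k act Local
    local-sameOrbits xs ys = local⇒orbit , orbit⇒local
      where
      local⇒orbit : (∃ λ σ → Local σ × (∀ i → to σ (xs i) ≡ ys i)) →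
                    ∃ λ a → ∀ i → act a (xs i) ≡ ys i
      local⇒orbit (σ , σ-local , σxs≡ys) with a , agree ← σ-local xs =
        a , λ i → trans (agree i) (σxs≡ys i)

      orbit⇒local : (∃ λ a → ∀ i → act a (xs i) ≡ ys i) →
                    ∃ λ σ → Local σ × (∀ i → to σ (xs i) ≡ ys i)
      orbit⇒local (a , axs≡ys) = actPerm a , isLocal-act act a , axs≡ys

module FinGroupProperties {n : ℕ} (G : FinGroup n) where
  open FinGroup G
  open ≡-Reasoning

  group : Group 0ℓ 0ℓ
  group = record
    { Carrier = Fin n
    ; _≈_     = _≡_
    ; _∙_     = _·_
    ; ε       = e
    ; _⁻¹     = inv
    ; isGroup = record
      { isMonoid = record
        { isSemigroup = record
          { isMagma = record { isEquivalence = isEquivalence ; ∙-cong = cong₂ _·_ }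
          ; assoc   = assoc
          }
        ; identity = identityˡ , identityʳ
        }
      ; inverse = inverseˡ , inverseʳ
      ; ⁻¹-cong = cong inv
      }
    }

  open GroupProperties group public
    using ( ∙-cancelʳ; ε⁻¹≈ε; ⁻¹-involutive; ⁻¹-anti-homo-∙; inverseʳ-unique
          ; x∙y⁻¹≈ε⇒x≈y; //-rightDividesˡ; \\-leftDividesˡ; \\-leftDividesʳ)
  open MonoidSolver (Group.monoid group) using (solve; _⊜_; _⊕_)

  innerHolAct-· : ∀ g h g′ h′ x →
    innerHolAct G (g · g′ , h · h′) x ≡ innerHolAct G (g′ , h′) (innerHolAct G (g , h) x)
  innerHolAct-· g h g′ h′ x = begin
    (inv (g · g′) · x) · (h · h′)
      ≡⟨ cong (λ t → (t · x) · (h · h′)) (⁻¹-anti-homo-∙ g g′) ⟩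
    ((inv g′ · inv g) · x) · (h · h′)
      ≡⟨ solve 5 (λ a b c d f → ((a ⊕ b) ⊕ c) ⊕ (d ⊕ f) ⊜ (a ⊕ ((b ⊕ c) ⊕ d)) ⊕ f)
               refl (inv g′) (inv g) x h h′ ⟩
    (inv g′ · ((inv g · x) · h)) · h′
      ∎

  right-quotient-cancel : ∀ x y a → (x · a) · inv (y · a) ≡ x · inv y
  right-quotient-cancel x y a = begin
    (x · a) · inv (y · a)
      ≡⟨ cong ((x · a) ·_) (⁻¹-anti-homo-∙ y a) ⟩
    (x · a) · (inv a · inv y)
      ≡⟨ solve 4 (λ x a a′ y′ → (x ⊕ a) ⊕ (a′ ⊕ y′) ⊜ x ⊕ ((a ⊕ a′) ⊕ y′))
               refl x a (inv a) (inv y) ⟩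
    x · ((a · inv a) · inv y)
      ≡⟨ cong (λ t → x · (t · inv y)) (inverseʳ a) ⟩
    x · (e · inv y)
      ≡⟨ cong (x ·_) (identityˡ (inv y)) ⟩
    x · inv y
      ∎

  -- Definitionally equal to innerHolAct G (g , g).
  conj : Fin n → Fin n → Fin n
  conj g x = (inv g · x) · g

  conj-isRightAction : IsRightAction G conj
  conj-isRightAction = record
    { act-e = λ x → trans (identityʳ _) (trans (cong (_· x) ε⁻¹≈ε) (identityˡ x))
    ; act-· = λ g h x → innerHolAct-· g g h h x
    }

  open IsRightAction conj-isRightAction public
    using () renaming (act-e to conj-e; act-· to conj-·)
  open RightActionProperties conj-isRightAction public
    using ()
    renaming ( act-inv-act to conj-inv-conj; act-act-inv to conj-conj-inv
             ; act-injective to conj-injective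
             ; act-≡⇒act-quotient to conj-≡⇒conj-quotient
             ; act-quotient⇒act-≡ to conj-quotient⇒conj-≡
             ; stabiliser-· to centraliser-·; stabiliser-inv to centraliser-inv)

  conj-homo-· : ∀ g a b → conj g (a · b) ≡ conj g a · conj g b
  conj-homo-· g a b = begin
    (inv g · (a · b)) · g
      ≡⟨ solve 4 (λ g′ a b g → (g′ ⊕ (a ⊕ b)) ⊕ g ⊜ (g′ ⊕ a) ⊕ (b ⊕ g)) refl (inv g) a b g ⟩
    (inv g · a) · (b · g)
      ≡⟨ cong ((inv g · a) ·_) (identityˡ (b · g)) ⟨
    (inv g · a) · (e · (b · g))
      ≡⟨ cong (λ t → (inv g · a) · (t · (b · g))) (inverseʳ g) ⟨
    (inv g · a) · ((g · inv g) · (b · g))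
      ≡⟨ solve 5 (λ x g g′ b y → x ⊕ ((g ⊕ g′) ⊕ (b ⊕ y)) ⊜ (x ⊕ g) ⊕ ((g′ ⊕ b) ⊕ y))
               refl (inv g · a) g (inv g) b g ⟩
    ((inv g · a) · g) · ((inv g · b) · g)
      ∎

  conj-homo-e : ∀ g → conj g e ≡ e
  conj-homo-e g = trans (cong (_· g) (identityʳ (inv g))) (inverseˡ g)

  conj-homo-inv : ∀ g a → conj g (inv a) ≡ inv (conj g a)
  conj-homo-inv g a = inverseʳ-unique (conj g a) (conj g (inv a)) (begin
    conj g a · conj g (inv a)  ≡⟨ conj-homo-· g a (inv a) ⟨
    conj g (a · inv a)         ≡⟨ cong (conj g) (inverseʳ a) ⟩
    conj g e                   ≡⟨ conj-homo-e g ⟩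
    e                          ∎)

  commute⇒conj-fixes : ∀ g b → g · b ≡ b · g → conj g b ≡ b
  commute⇒conj-fixes g b gb≡bg = begin
    (inv g · b) · g  ≡⟨ assoc (inv g) b g ⟩
    inv g · (b · g)  ≡⟨ cong (inv g ·_) gb≡bg ⟨
    inv g · (g · b)  ≡⟨ \\-leftDividesʳ g b ⟩
    b                ∎

  conj-fixes⇒commute : ∀ g b → conj g b ≡ b → g · b ≡ b · g
  conj-fixes⇒commute g b fixes = begin
    g · b                  ≡⟨ cong (g ·_) fixes ⟨
    g · ((inv g · b) · g)  ≡⟨ assoc g (inv g · b) g ⟨
    (g · (inv g · b)) · g  ≡⟨ cong (_· g) (\\-leftDividesˡ g b) ⟩
    b · g                  ∎

  conj-fixes-sym : ∀ {g b} → conj g b ≡ b → conj b g ≡ g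
  conj-fixes-sym {g} {b} fixes = commute⇒conj-fixes b g (sym (conj-fixes⇒commute g b fixes))

module InnerHolomorph {n : ℕ} (F : FinGroup n) where
  open FinGroup F
  open FinGroupProperties F

  ι : Fin n × Fin n → Fin n → Fin n
  ι = innerHolAct F

  _⊗_ : Fin n × Fin n → Fin n × Fin n → Fin n × Fin n
  (g , h) ⊗ (g′ , h′) = g · g′ , h · h′

  ι-⊗ : ∀ p q x → ι (p ⊗ q) x ≡ ι q (ι p x)
  ι-⊗ (g , h) (g′ , h′) = innerHolAct-· g h g′ h′

  isLocal-postcompose : ∀ {k f} p → IsLocal k ι f → IsLocal k ι (ι p ∘ f)
  isLocal-postcompose {f = f} p f-local = isLocal-∘ ι ι-⊗ {f} {ι p} f-local (isLocal-act ι p)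

  isLocal-precompose : ∀ {k f} p → IsLocal k ι f → IsLocal k ι (f ∘ ι p)
  isLocal-precompose {f = f} p f-local = isLocal-∘ ι ι-⊗ {ι p} {f} (isLocal-act ι p) f-local

  ι-right : ∀ h x → ι (e , h) x ≡ x · h
  ι-right h x = cong (_· h) (trans (cong (_· x) ε⁻¹≈ε) (identityˡ x))

  isLocal₃-fixing-e⇒locally-conj : ∀ {f} → IsLocal 3 ι f → f e ≡ e →
                                   ∀ x y → ∃ λ g → f x ≡ conj g x × f y ≡ conj g y
  isLocal₃-fixing-e⇒locally-conj {f} f-local fe x y
    with (g , h) , agree ← f-local (lookup (e ∷ x ∷ y ∷ []))
    = g , trans (sym (agree (suc zero))) (cong (λ t → (inv g · x) · t) h≡g)
        , trans (sym (agree (suc (suc zero)))) (cong (λ t → (inv g · y) · t) h≡g)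
    where
    g⁻¹h≡e : inv g · h ≡ e
    g⁻¹h≡e = trans (cong (_· h) (sym (identityʳ (inv g)))) (trans (agree zero) fe)

    h≡g : h ≡ g
    h≡g = trans (inverseʳ-unique (inv g) h g⁻¹h≡e) (⁻¹-involutive g)

module FrobeniusComplement {n} {F : FinGroup n} {H : Subset n}
                           (frob : IsFrobeniusComplement F H) where
  open FinGroup F
  open FinGroupProperties F
  open IsFrobeniusComplement frob
  open IsSubgroup subgroup

  conj-∈⇒∈ : ∀ {g b} → b ∈ H → b ≢ e → conj g b ∈ H → g ∈ H
  conj-∈⇒∈ {g} {b} b∈H b≢e bᵍ∈H with g ∈? H
  ... | yes g∈H = g∈H
  ... | no  g∉H = contradiction (malnormal g g∉H b b∈H bᵍ∈H) b≢e

  centralises⇒∈ : ∀ {g b} → b ∈ H → b ≢ e → conj g b ≡ b → g ∈ H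
  centralises⇒∈ b∈H b≢e fixes = conj-∈⇒∈ b∈H b≢e (subst (_∈ H) (sym fixes) b∈H)

  conj-≡⇒quotient∈ : ∀ {g g′ b} → b ∈ H → b ≢ e → conj g b ≡ conj g′ b → g · inv g′ ∈ H
  conj-≡⇒quotient∈ b∈H b≢e eq = centralises⇒∈ b∈H b≢e (conj-≡⇒conj-quotient eq)

  centralises-conjugate⇒∈conjugate : ∀ {x y b} → b ∈ H → b ≢ e →
                                     conj y (conj x b) ≡ conj x b → conj (inv x) y ∈ H
  centralises-conjugate⇒∈conjugate {x} {y} {b} b∈H b≢e fixes =
    subst (_∈ H) (cong (λ t → (t · y) · inv x) (sym (⁻¹-involutive x)))
          (conj-≡⇒quotient∈ b∈H b≢e (trans (conj-· x y b) fixes))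

  ∈∩conjugate⇒e : ∀ {z d b} → z ∉ H → d ∈ H → b ∈ H → b ≢ e →
                  conj d (conj z b) ≡ conj z b → d ≡ e
  ∈∩conjugate⇒e {z} z∉H d∈H b∈H b≢e fixes =
    malnormal (inv z) z⁻¹∉H _ d∈H (centralises-conjugate⇒∈conjugate b∈H b≢e fixes)
    where
    z⁻¹∉H : inv z ∉ H
    z⁻¹∉H z⁻¹∈H = z∉H (subst (_∈ H) (⁻¹-involutive z) (inv∈ z⁻¹∈H))

  InConjugate : Fin n → Set
  InConjugate y = ∃ λ x → conj x y ∈ H

  inConjugate? : ∀ y → Dec (InConjugate y)
  inConjugate? y = any? (λ x → conj x y ∈? H)

  ∈⇒inConjugate : ∀ {b} → b ∈ H → InConjugate b
  ∈⇒inConjugate {b} b∈H = e , subst (_∈ H) (sym (conj-e b)) b∈H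

  conj⇒inConjugate : ∀ {x b} → b ∈ H → InConjugate (conj x b)
  conj⇒inConjugate {x} {b} b∈H = inv x , subst (_∈ H) (sym (conj-inv-conj x b)) b∈H

  centralises-nontrivial⇒inConjugate : ∀ {x b z} → b ∈ H → b ≢ e →
                                       conj (conj x b) z ≡ z → InConjugate z
  centralises-nontrivial⇒inConjugate b∈H b≢e fixes =
    _ , centralises-conjugate⇒∈conjugate b∈H b≢e (conj-fixes-sym fixes)

module RightCosetAction {n} {F : FinGroup n} {H : Subset n} {Ω : Set}
                        {act : Fin n → Ω → Ω} {ω₀ : Ω}
                        (coset : IsRightCosetAction F H act ω₀) where
  open FinGroup F
  open IsRightCosetAction coset
  open RightActionProperties action

  act-≡⇒quotient∈ : ∀ {g g′} → act g ω₀ ≡ act g′ ω₀ → g · inv g′ ∈ H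
  act-≡⇒quotient∈ eq = proj₁ (stabiliser _) (act-≡⇒act-quotient eq)

  quotient∈⇒act-≡ : ∀ {g g′} → g · inv g′ ∈ H → act g ω₀ ≡ act g′ ω₀
  quotient∈⇒act-≡ q∈H = act-quotient⇒act-≡ (proj₂ (stabiliser _) q∈H)

  rep : Ω → Fin n
  rep ω = proj₁ (transitive ω₀ ω)

  rep-spec : ∀ ω → act (rep ω) ω₀ ≡ ω
  rep-spec ω = proj₂ (transitive ω₀ ω)

module TwoClosedCosetAction
  {n} (F : FinGroup n) (H : Subset n)
  (frob : IsFrobeniusComplement F H) (abel : IsAbelianSubset F H)
  {m} (act : Fin n → Fin m → Fin m) (ω₀ : Fin m)
  (coset : IsRightCosetAction F H act ω₀) (closed₂ : IsKClosed 2 act) where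

  open FinGroup F
  open FinGroupProperties F
  open InnerHolomorph F
  open FrobeniusComplement frob
  open IsFrobeniusComplement frob using (subgroup; nontrivial)
  open IsSubgroup subgroup
  open RightCosetAction coset
  open IsRightCosetAction coset using (action)
  open IsRightAction action
  open RightActionProperties action
  open ≡-Reasoning

  ∈⇒centralises : ∀ {g b} → g ∈ H → b ∈ H → conj g b ≡ b
  ∈⇒centralises g∈H b∈H = commute⇒conj-fixes _ _ (abel _ _ g∈H b∈H)

  h₀ : Fin n
  h₀ = proj₁ nontrivial

  h₀∈H : h₀ ∈ H
  h₀∈H = proj₁ (proj₂ nontrivial)

  h₀≢e : h₀ ≢ e
  h₀≢e = proj₂ (proj₂ nontrivial)

  -- Since the centraliser of h₀ is H, the conjugate h₀ˣ determines the coset Hx.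
  act-agree⇒conj-agree : ∀ {g g′ b} → b ∈ H → act g ω₀ ≡ act g′ ω₀ → conj g b ≡ conj g′ b
  act-agree⇒conj-agree b∈H eq =
    conj-quotient⇒conj-≡ (∈⇒centralises (act-≡⇒quotient∈ eq) b∈H)

  conj-agree⇒act-agree : ∀ {g g′} → conj g h₀ ≡ conj g′ h₀ → act g ω₀ ≡ act g′ ω₀
  conj-agree⇒act-agree eq = quotient∈⇒act-≡ (conj-≡⇒quotient∈ h₀∈H h₀≢e eq)

  act-agree-at⇒conj-agree-at : ∀ {g g′ x b} → b ∈ H →
    act g (act x ω₀) ≡ act g′ (act x ω₀) → conj g (conj x b) ≡ conj g′ (conj x b)
  act-agree-at⇒conj-agree-at {g} {g′} {x} {b} b∈H eq = begin
    conj g (conj x b)   ≡⟨ conj-· x g b ⟨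
    conj (x · g) b      ≡⟨ act-agree⇒conj-agree b∈H (trans (act-· x g ω₀)
                                                      (trans eq (sym (act-· x g′ ω₀)))) ⟩
    conj (x · g′) b     ≡⟨ conj-· x g′ b ⟩
    conj g′ (conj x b)  ∎

  conj-agree-at⇒act-agree-at : ∀ {g g′ x} →
    conj g (conj x h₀) ≡ conj g′ (conj x h₀) → act g (act x ω₀) ≡ act g′ (act x ω₀)
  conj-agree-at⇒act-agree-at {g} {g′} {x} eq = begin
    act g (act x ω₀)   ≡⟨ act-· x g ω₀ ⟨
    act (x · g) ω₀     ≡⟨ conj-agree⇒act-agree (trans (conj-· x g h₀)
                                                 (trans eq (sym (conj-· x g′ h₀)))) ⟩
    act (x · g′) ω₀    ≡⟨ act-· x g′ ω₀ ⟩
    act g′ (act x ω₀)  ∎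

  -- f permutes the conjugates of h₀, hence the cosets of H; the induced permutation π
  -- preserves the 2-orbits of F, so by 2-closedness it is some c ∈ F.
  module InducedCosetPermutation {f} (f-local : IsLocal 3 ι f) (fe : f e ≡ e) where

    locally-conj : ∀ x y → ∃ λ g → f x ≡ conj g x × f y ≡ conj g y
    locally-conj = isLocal₃-fixing-e⇒locally-conj f-local fe

    g : Fin m → Fin n
    g ω = proj₁ (locally-conj (conj (rep ω) h₀) (conj (rep ω) h₀))

    π : Fin m → Fin m
    π ω = act (g ω) ω

    π-spec : ∀ {g′ x ω} → act x ω₀ ≡ ω → f (conj x h₀) ≡ conj g′ (conj x h₀) → act g′ ω ≡ π ω
    π-spec {g′} {x} refl f-at-x = conj-agree-at⇒act-agree-at (begin
      conj g′ (conj x h₀)     ≡⟨ f-at-x ⟨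
      f (conj x h₀)           ≡⟨ cong f rʰ≡xʰ ⟨
      f (conj r h₀)           ≡⟨ proj₁ (proj₂ (locally-conj (conj r h₀) (conj r h₀))) ⟩
      conj (g ω) (conj r h₀)  ≡⟨ cong (conj (g ω)) rʰ≡xʰ ⟩
      conj (g ω) (conj x h₀)  ∎)
      where
      ω = act x ω₀
      r = rep ω

      rʰ≡xʰ : conj r h₀ ≡ conj x h₀
      rʰ≡xʰ = act-agree⇒conj-agree h₀∈H (rep-spec ω)

    π-local : IsLocal 2 act π
    π-local ωs
      with g′ , f-at-0 , f-at-1 ← locally-conj (conj (rep (ωs zero)) h₀)
                                                (conj (rep (ωs (suc zero))) h₀)
      = g′ , λ { zero → π-spec (rep-spec _) f-at-0 ; (suc zero) → π-spec (rep-spec _) f-at-1 }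

    π≡act-c : ∃ λ c → ∀ ω → π ω ≡ act c ω
    π≡act-c = kClosed⇒isLocal⇒inImage action closed₂ (isLocal₂⇒injective {π} π-local) π-local

    c : Fin n
    c = proj₁ π≡act-c

    f-on-conjugates : ∀ x {b} → b ∈ H → f (conj x b) ≡ conj c (conj x b)
    f-on-conjugates x {b} b∈H =
      let g′ , f-at-h₀ˣ , f-at-bˣ = locally-conj (conj x h₀) (conj x b) in
      trans f-at-bˣ (act-agree-at⇒conj-agree-at b∈H
                      (trans (π-spec refl f-at-h₀ˣ) (proj₂ π≡act-c (act x ω₀))))

  conj-on-U : ∀ {f} → IsLocal 3 ι f → f e ≡ e →
              ∃ λ c → ∀ y → InConjugate y → f y ≡ conj c y
  conj-on-U {f} f-local fe = c , λ y (x , yˣ∈H) →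
    subst (λ t → f t ≡ conj c t) (conj-inv-conj x y) (f-on-conjugates (inv x) yˣ∈H)
    where open InducedCosetPermutation f-local fe

  module Moved {f} (f-local : IsLocal 3 ι f) (fe : f e ≡ e)
               (fixes-U : ∀ y → InConjugate y → f y ≡ y)
               {z} (z∉U : ¬ InConjugate z) (fz≢z : f z ≢ z) where

    locally-conj : ∀ x y → ∃ λ g → f x ≡ conj g x × f y ≡ conj g y
    locally-conj = isLocal₃-fixing-e⇒locally-conj f-local fe

    centralises-z⇒e : ∀ {x b} → b ∈ H → conj (conj x b) z ≡ z → b ≡ e
    centralises-z⇒e {b = b} b∈H fixes with b ≟ e
    ... | yes b≡e = b≡e
    ... | no  b≢e = contradiction (centralises-nontrivial⇒inConjugate b∈H b≢e fixes) z∉U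

    ∈∧centralises-z⇒e : ∀ {b} → b ∈ H → conj b z ≡ z → b ≡ e
    ∈∧centralises-z⇒e {b} b∈H fixes =
      centralises-z⇒e {x = e} b∈H (subst (λ t → conj t z ≡ z) (sym (conj-e b)) fixes)

    g : Fin n → Fin n
    g x = proj₁ (locally-conj (conj x h₀) z)

    g-fixes : ∀ x → conj (g x) (conj x h₀) ≡ conj x h₀
    g-fixes x = trans (sym (proj₁ (proj₂ (locally-conj (conj x h₀) z))))
                      (fixes-U _ (conj⇒inConjugate h₀∈H))

    g-moves : ∀ x → f z ≡ conj (g x) z
    g-moves x = proj₂ (proj₂ (locally-conj (conj x h₀) z))

    g≢e : ∀ x → g x ≢ e
    g≢e x gx≡e = fz≢z (trans (g-moves x) (trans (cong (λ t → conj t z) gx≡e) (conj-e z)))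

    gᴴ : Fin n → Fin n
    gᴴ x = conj (inv x) (g x)

    gᴴ∈H : ∀ x → gᴴ x ∈ H
    gᴴ∈H x = centralises-conjugate⇒∈conjugate h₀∈H h₀≢e (g-fixes x)

    gᴴ≢e : ∀ x → gᴴ x ≢ e
    gᴴ≢e x eq = g≢e x (conj-injective (inv x) (trans eq (sym (conj-homo-e (inv x)))))

    c : Fin n → Fin n
    c x = g x · inv (g e)

    c-centralises : ∀ x → conj (c x) z ≡ z
    c-centralises x = conj-≡⇒conj-quotient (trans (sym (g-moves x)) (g-moves e))

    c-≡⇒act-≡ : ∀ {x y} → c x ≡ c y → act x ω₀ ≡ act y ω₀
    c-≡⇒act-≡ {x} {y} cx≡cy = quotient∈⇒act-≡ (conj-∈⇒∈ (gᴴ∈H x) (gᴴ≢e x)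
      (subst (_∈ H) (sym (conj-≡⇒conj-quotient gᴴˣ≡gᴴʸ)) (gᴴ∈H y)))
      where
      gᴴˣ≡gᴴʸ : conj x (gᴴ x) ≡ conj y (gᴴ y)
      gᴴˣ≡gᴴʸ = trans (conj-conj-inv x (g x))
                  (trans (∙-cancelʳ (inv (g e)) (g x) (g y) cx≡cy) (sym (conj-conj-inv y (g y))))

    r : Fin n → Fin n
    r x = rep (act x ω₀)

    s : Fin n → Fin n
    s x = x · inv (r x)

    s∈H : ∀ x → s x ∈ H
    s∈H x = act-≡⇒quotient∈ (sym (rep-spec (act x ω₀)))

    c-≡∧s-≡⇒≡ : ∀ {x y} → c x ≡ c y → s x ≡ s y → x ≡ y
    c-≡∧s-≡⇒≡ {x} {y} cx≡cy sx≡sy = begin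
      x          ≡⟨ //-rightDividesˡ (r x) x ⟨
      s x · r x  ≡⟨ cong₂ _·_ sx≡sy (cong rep (c-≡⇒act-≡ cx≡cy)) ⟩
      s y · r y  ≡⟨ //-rightDividesˡ (r y) y ⟩
      y          ∎

    -- E is injective, hence onto.  Its values with s x ≢ e lie in U, so every
    -- element outside U is some c x, and therefore centralises z.
    E′ : ∀ x → Dec (s x ≡ e) → Fin n
    E′ x (yes _) = c x
    E′ x (no  _) = conj (c x) (s x)

    E : Fin n → Fin n
    E x = E′ x (s x ≟ e)

    E′-injective : ∀ x y dx dy → E′ x dx ≡ E′ y dy → x ≡ y
    E′-injective x y (yes sx≡e) (yes sy≡e) eq = c-≡∧s-≡⇒≡ eq (trans sx≡e (sym sy≡e))
    E′-injective x y (yes _) (no sy≢e) eq = contradiction (centralises-z⇒e (s∈H y)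
      (subst (λ t → conj t z ≡ z) eq (c-centralises x))) sy≢e
    E′-injective x y (no sx≢e) (yes _) eq = contradiction (centralises-z⇒e (s∈H x)
      (subst (λ t → conj t z ≡ z) (sym eq) (c-centralises y))) sx≢e
    E′-injective x y (no sx≢e) (no _) eq = c-≡∧s-≡⇒≡ cx≡cy
      (conj-injective (c x) (trans eq (cong (λ t → conj t (s y)) (sym cx≡cy))))
      where
      t∈H : c x · inv (c y) ∈ H
      t∈H = conj-∈⇒∈ (s∈H x) sx≢e (subst (_∈ H) (sym (conj-≡⇒conj-quotient eq)) (s∈H y))

      cx≡cy : c x ≡ c y
      cx≡cy = x∙y⁻¹≈ε⇒x≈y (c x) (c y) (∈∧centralises-z⇒e t∈H
                (centraliser-· (c-centralises x) (centraliser-inv (c-centralises y))))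

    E-injective : Injective _≡_ _≡_ E
    E-injective {x} {y} = E′-injective x y (s x ≟ e) (s y ≟ e)

    E′-outside-U⇒centralises : ∀ x dx → ¬ InConjugate (E′ x dx) → conj (E′ x dx) z ≡ z
    E′-outside-U⇒centralises x (yes _) _  = c-centralises x
    E′-outside-U⇒centralises x (no  _) ∉U = contradiction (conj⇒inConjugate (s∈H x)) ∉U

    outside-U⇒centralises : ∀ {y} → ¬ InConjugate y → conj y z ≡ z
    outside-U⇒centralises {y} y∉U =
      let x , Ex≡y = injective⇒surjective E-injective y in
      subst (λ t → conj t z ≡ z) Ex≡y
        (E′-outside-U⇒centralises x (s x ≟ e) (subst (¬_ ∘ InConjugate) (sym Ex≡y) y∉U))

    za⁻¹∈U : ∀ {a} → a ∈ H → a ≢ e → InConjugate (z · inv a)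
    za⁻¹∈U {a} a∈H a≢e with inConjugate? (z · inv a)
    ... | yes ∈U = ∈U
    ... | no  ∉U = contradiction (∈∧centralises-z⇒e a∈H a-centralises) a≢e
      where
      a⁻¹-centralises : conj (inv a) z ≡ z
      a⁻¹-centralises = subst (λ t → conj t z ≡ z) (\\-leftDividesʳ z (inv a))
        (centraliser-· (centraliser-inv (commute⇒conj-fixes z z refl)) (outside-U⇒centralises ∉U))

      a-centralises : conj a z ≡ z
      a-centralises = subst (λ t → conj t z ≡ z) (⁻¹-involutive a) (centraliser-inv a⁻¹-centralises)

    bᶻa∈U : ∀ {a b} → a ∈ H → b ∈ H → a ≢ e → b ≢ e → b ≢ a →
            ∃ λ b′ → b′ ∈ H × b′ ≢ e × InConjugate (conj z b′ · a)
    bᶻa∈U {a} {b} a∈H b∈H a≢e b≢e b≢a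
      with inConjugate? (conj z a · a) | inConjugate? (conj z b · a)
    ... | yes ∈U | _      = a , a∈H , a≢e , ∈U
    ... | no _   | yes ∈U = b , b∈H , b≢e , ∈U
    ... | no ∉U₁ | no ∉U₂ =
      contradiction (x∙y⁻¹≈ε⇒x≈y a b (centralises-z⇒e (·∈ a∈H (inv∈ b∈H)) quotient-centralises))
                    (b≢a ∘ sym)
      where
      quotient≡ : (conj z a · a) · inv (conj z b · a) ≡ conj z (a · inv b)
      quotient≡ = begin
        (conj z a · a) · inv (conj z b · a)  ≡⟨ right-quotient-cancel (conj z a) (conj z b) a ⟩
        conj z a · inv (conj z b)            ≡⟨ cong (conj z a ·_) (conj-homo-inv z b) ⟨
        conj z a · conj z (inv b)            ≡⟨ conj-homo-· z a (inv b) ⟨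
        conj z (a · inv b)                   ∎

      quotient-centralises : conj (conj z (a · inv b)) z ≡ z
      quotient-centralises = subst (λ t → conj t z ≡ z) quotient≡
        (centraliser-· (outside-U⇒centralises ∉U₁) (centraliser-inv (outside-U⇒centralises ∉U₂)))

    module Shifted {a} (a∈H : a ∈ H) (a≢e : a ≢ e) where

      fₐ : Fin n → Fin n
      fₐ = ι (e , inv a) ∘ f ∘ ι (e , a)

      fₐ-local : IsLocal 3 ι fₐ
      fₐ-local = isLocal-postcompose {f = f ∘ ι (e , a)} (e , inv a)
                   (isLocal-precompose {f = f} (e , a) f-local)

      fₐ-· : ∀ y → fₐ y · a ≡ f (y · a)
      fₐ-· y = begin
        fₐ y · a                 ≡⟨ cong (_· a) (trans (ι-right (inv a) _)
                                                       (cong (λ t → f t · inv a) (ι-right a y))) ⟩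
        (f (y · a) · inv a) · a  ≡⟨ //-rightDividesˡ a (f (y · a)) ⟩
        f (y · a)                ∎

      fₐ-fixes : ∀ {y} → InConjugate (y · a) → fₐ y ≡ y
      fₐ-fixes {y} ya∈U = ∙-cancelʳ a (fₐ y) y (trans (fₐ-· y) (fixes-U _ ya∈U))

      fₐ-e : fₐ e ≡ e
      fₐ-e = fₐ-fixes (∈⇒inConjugate (subst (_∈ H) (sym (identityˡ a)) a∈H))

      d-spec : ∃ λ d → ∀ y → InConjugate y → fₐ y ≡ conj d y
      d-spec = conj-on-U fₐ-local fₐ-e

      d : Fin n
      d = proj₁ d-spec

      d∈H : d ∈ H
      d∈H = centralises⇒∈ a∈H a≢e (trans (sym (proj₂ d-spec a (∈⇒inConjugate a∈H)))
                                          (fₐ-fixes (∈⇒inConjugate (·∈ a∈H a∈H))))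

      d≡e : ∀ {b} → b ∈ H → b ≢ e → InConjugate (conj z b · a) → d ≡ e
      d≡e b∈H b≢e bᶻa∈U′ = ∈∩conjugate⇒e (z∉U ∘ ∈⇒inConjugate) d∈H b∈H b≢e
        (trans (sym (proj₂ d-spec _ (conj⇒inConjugate b∈H))) (fₐ-fixes bᶻa∈U′))

      d≡e⇒fz≡z : d ≡ e → f z ≡ z
      d≡e⇒fz≡z d≡e = begin
        f z                     ≡⟨ cong f (//-rightDividesˡ a z) ⟨
        f ((z · inv a) · a)     ≡⟨ fₐ-· (z · inv a) ⟨
        fₐ (z · inv a) · a      ≡⟨ cong (_· a) (proj₂ d-spec _ (za⁻¹∈U a∈H a≢e)) ⟩
        conj d (z · inv a) · a  ≡⟨ cong (λ t → conj t (z · inv a) · a) d≡e ⟩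
        conj e (z · inv a) · a  ≡⟨ cong (_· a) (conj-e (z · inv a)) ⟩
        (z · inv a) · a         ≡⟨ //-rightDividesˡ a z ⟩
        z                       ∎

    impossible : ∀ {a b} → a ∈ H → b ∈ H → a ≢ e → b ≢ e → b ≢ a → ⊥
    impossible a∈H b∈H a≢e b≢e b≢a =
      let _ , b′∈H , b′≢e , b′ᶻa∈U = bᶻa∈U a∈H b∈H a≢e b≢e b≢a in
      fz≢z (d≡e⇒fz≡z (d≡e b′∈H b′≢e b′ᶻa∈U))
      where open Shifted a∈H a≢e

  fixing-U⇒id : 2 < ∣ H ∣ → ∀ {f} → IsLocal 3 ι f → f e ≡ e →
                (∀ y → InConjugate y → f y ≡ y) → ∀ z → f z ≡ z
  fixing-U⇒id 2<∣H∣ {f} f-local fe fixes-U z with inConjugate? z | f z ≟ z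
  ... | yes z∈U | _        = fixes-U z z∈U
  ... | no  _   | yes fz≡z = fz≡z
  ... | no  z∉U | no  fz≢z =
    let a , a∈H , a≢e , _   = 2<∣p∣⇒∃∈-avoiding 2<∣H∣ e e
        b , b∈H , b≢e , b≢a = 2<∣p∣⇒∃∈-avoiding 2<∣H∣ e a
    in ⊥-elim (Moved.impossible f-local fe fixes-U z∉U fz≢z a∈H b∈H a≢e b≢e b≢a)

  isLocal₃⇒innerHol : 2 < ∣ H ∣ → ∀ {f} → IsLocal 3 ι f → ∃ λ p → ∀ x → f x ≡ ι p x
  isLocal₃⇒innerHol 2<∣H∣ {f} f-local = (c , c · f e) , f≡ι
    where
    ρ : Fin n → Fin n
    ρ = ι (e , inv (f e)) ∘ f

    ρ-e : ρ e ≡ e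
    ρ-e = trans (ι-right (inv (f e)) (f e)) (inverseʳ (f e))

    ρ-local : IsLocal 3 ι ρ
    ρ-local = isLocal-postcompose {f = f} (e , inv (f e)) f-local

    c-spec : ∃ λ c → ∀ y → InConjugate y → ρ y ≡ conj c y
    c-spec = conj-on-U ρ-local ρ-e

    c : Fin n
    c = proj₁ c-spec

    c⁻¹ρ≡id : ∀ x → conj (inv c) (ρ x) ≡ x
    c⁻¹ρ≡id = fixing-U⇒id 2<∣H∣ (isLocal-postcompose {f = ρ} (inv c , inv c) ρ-local)
      (trans (cong (conj (inv c)) ρ-e) (conj-homo-e (inv c)))
      (λ y y∈U → trans (cong (conj (inv c)) (proj₂ c-spec y y∈U)) (conj-inv-conj c y))

    f≡ι : ∀ x → f x ≡ (inv c · x) · (c · f e)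
    f≡ι x = begin
      f x                                ≡⟨ //-rightDividesˡ (f e) (f x) ⟨
      (f x · inv (f e)) · f e            ≡⟨ cong (_· f e) (ι-right (inv (f e)) (f x)) ⟨
      ρ x · f e                          ≡⟨ cong (_· f e) (conj-conj-inv c (ρ x)) ⟨
      conj c (conj (inv c) (ρ x)) · f e  ≡⟨ cong (λ t → conj c t · f e) (c⁻¹ρ≡id x) ⟩
      conj c x · f e                     ≡⟨ assoc (inv c · x) c (f e) ⟩
      (inv c · x) · (c · f e)            ∎

proposition7p1 : ∀ {n : ℕ} (F : FinGroup n) (H : Subset n)
    → IsFrobeniusComplement F H
    → IsAbelianSubset F H
    → ∀ {m : ℕ} (act : Fin n → Fin m → Fin m) (ω₀ : Fin m)
    → IsRightCosetAction F H act ω₀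
    → IsKClosed 2 act
    → 2 < ∣ H ∣
    → IsKClosed 3 (innerHolAct F)
proposition7p1 F H frob abel act ω₀ coset closed₂ 2<∣H∣ K _ sameOrbits σ σ∈K =
  isLocal₃⇒innerHol 2<∣H∣ (sameOrbits⇒isLocal {act = innerHolAct F} sameOrbits σ∈K)
  where open TwoClosedCosetAction F H frob abel act ω₀ coset closed₂
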